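{- Let $q$ be a prime power and let $M$ be a finite matroid. If the lattice $\mathcal{Z}(M)$ of cyclic flats of $M$ is a chain with at least $q+2$ elements, then $M$ is not representable over $\mathrm{GF}(q)$.
   Context: A flat of a matroid is cyclic if it is a (possibly empty) union of circuits. $\mathcal{Z}(M)$ denotes the set of cyclic flats of $M$ ordered by inclusion (a lattice). A chain is a linearly ordered set. -}

module Defs where

open import Level using (0ℓ)
open import Data.Nat using (ℕ; zero; suc; _+_; _^_; _≤_; _<_)
open import Data.Nat.Primality using (Prime)
open import Data.Fin using (Fin; zero; suc)
open import Data.Fin.Subset using (Subset; _∈_; _∉_; _⊆_; _∪_; ⁅_⁆; ∣_∣; ⊥)
open import Data.Sum using (_⊎_)
open import Data.Product using (Σ; ∃; ∃-syntax; _×_; _,_)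
open import Relation.Binary.PropositionalEquality using (_≡_; _≢_)
open import Relation.Nullary using (¬_)
open import Algebra.Structures using (IsCommutativeRing)
open import Function.Definitions using (Injective)

IsPrimePower : ℕ → Set
IsPrimePower q = Σ ℕ λ p → Σ ℕ λ k → Prime p × q ≡ p ^ suc k

record Matroid (n : ℕ) : Set₁ where
  field
    Indep      : Subset n → Set
    indep-⊥    : Indep ⊥
    indep-⊆    : ∀ {X Y} → Indep Y → X ⊆ Y → Indep X
    indep-aug  : ∀ {X Y} → Indep X → Indep Y → ∣ X ∣ < ∣ Y ∣ →
                 ∃[ e ] (e ∈ Y × e ∉ X × Indep (X ∪ ⁅ e ⁆))

module _ {n : ℕ} (M : Matroid n) where
  open Matroid M

  HasRank : Subset n → ℕ → Set
  HasRank X k = (∃[ I ] (I ⊆ X × Indep I × ∣ I ∣ ≡ k))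
              × (∀ I → I ⊆ X → Indep I → ∣ I ∣ ≤ k)

  IsFlat : Subset n → Set
  IsFlat F = ∀ e → e ∉ F → ∀ k → HasRank F k → ¬ HasRank (F ∪ ⁅ e ⁆) k

  IsCircuit : Subset n → Set
  IsCircuit C = ¬ Indep C × (∀ D → D ⊆ C → D ≢ C → Indep D)

  IsUnionOfCircuits : Subset n → Set
  IsUnionOfCircuits F = ∀ e → e ∈ F → ∃[ C ] (IsCircuit C × C ⊆ F × e ∈ C)

  IsCyclicFlat : Subset n → Set
  IsCyclicFlat F = IsFlat F × IsUnionOfCircuits F

  CyclicFlatsChain : Set
  CyclicFlatsChain = ∀ X Y → IsCyclicFlat X → IsCyclicFlat Y → X ⊆ Y ⊎ Y ⊆ X

  AtLeastCyclicFlats : ℕ → Set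
  AtLeastCyclicFlats m = Σ (Fin m → Subset n) λ f →
                           Injective _≡_ _≡_ f × (∀ i → IsCyclicFlat (f i))

record IsFieldOn (K : Set) : Set where
  field
    _+ᴷ_ _*ᴷ_ : K → K → K
    -ᴷ_       : K → K
    0ᴷ 1ᴷ     : K
    isCommutativeRing : IsCommutativeRing _≡_ _+ᴷ_ _*ᴷ_ -ᴷ_ 0ᴷ 1ᴷ
    0≢1       : 0ᴷ ≢ 1ᴷ
    inverse   : ∀ x → x ≢ 0ᴷ → ∃[ y ] (x *ᴷ y ≡ 1ᴷ)

  Σᴷ : ∀ {m} → (Fin m → K) → K
  Σᴷ {zero}  f = 0ᴷ
  Σᴷ {suc m} f = f zero +ᴷ Σᴷ (λ i → f (suc i))

  LinIndepOn : ∀ {m r} → (Fin m → Fin r → K) → Subset m → Set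
  LinIndepOn {m} v X = ∀ (c : Fin m → K) → (∀ e → e ∉ X → c e ≡ 0ᴷ) →
                       (∀ j → Σᴷ (λ e → c e *ᴷ v e j) ≡ 0ᴷ) →
                       ∀ e → c e ≡ 0ᴷ

RepresentableOver : ∀ {n} {K : Set} → IsFieldOn K → Matroid n → Set
RepresentableOver {n} {K} 𝔽 M =
  Σ ℕ λ r → Σ (Fin n → Fin r → K) λ v →
    ∀ X → (Matroid.Indep M X → IsFieldOn.LinIndepOn 𝔽 v X)
        × (IsFieldOn.LinIndepOn 𝔽 v X → Matroid.Indep M X)

{-# OPTIONS --safe #-}

-- Let Z′ ⊂ Z be consecutive members of the chain Z(M). A circuit inside Z but not inside Z′ spans a
-- cyclic flat that can only be Z, so it has exactly r(Z) + 1 elements; hence a subset of Z with at most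
-- r(Z) elements is independent as soon as its trace on Z′ is. This lifts a set C ⊆ Z′ with points
-- p₀, …, p_{m-1} such that each C ∪ {pᵢ, pⱼ} is a basis of Z′ (a U_{2,m} minor of M|Z′) to Z, adding
-- r(Z) − r(Z′) elements of Z ∖ Z′ to C and one more point from Z ∖ Z′. A chain of q + 2 cyclic flats
-- thus yields U_{2,q+2}. Over a field with q elements, scale each dependency among C ∪ {p₀, p₁, p_{k+2}}
-- to have coefficient 1 at p₀: its coefficient at p₁ is nonzero and determines k, but only q − 1 nonzero
-- values are available.

module Submission where

open import Defs
open import Data.Nat using (ℕ; _+_)
open import Data.Fin using (Fin)
open import Relation.Nullary using (¬_)

open import Level using (0ℓ)
open import Data.Nat using (zero; suc; _∸_; _≤_; _<_; _≟_; _<?_; z≤n; s≤s)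
open import Data.Nat.Properties
  using (≤-trans; n≤1+n; +-monoʳ-≤; ≤-antisym; ≤-reflexive; <⇒≱; ≮⇒≥; 1+n≰n; n≮0; +-suc; +-comm;
         +-monoˡ-≤; +-cancelˡ-≤; ∸-monoʳ-<; m≤n⇒∃[o]m+o≡n; module ≤-Reasoning)
open import Data.Nat.Induction using (<-rec)
open import Data.Fin using (zero; suc; punchIn; punchOut) renaming (_≟_ to _≟ᶠ_)
open import Data.Fin.Properties
  using (any?; suc-injective; ∀-cons; ¬∀⟶∃¬; punchIn-injective; punchInᵢ≢i; punchOut-injective; injective⇒≤)
open import Data.Fin.Subset
  using (Subset; inside; outside; _∈_; _∉_; _⊆_; _⊈_; _⊂_; _∪_; _∩_; _─_; _-_; ⁅_⁆; ∣_∣; ⊥)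
open import Data.Fin.Subset.Properties
  using (_∈?_; _⊆?_; ⊆-refl; ⊆-trans; ⊆-antisym; ⊆-min; ⊂-irref; p⊆q⇒∣p∣≤∣q∣; p⊂q⇒∣p∣<∣q∣; ∣p∣≤n; ∣⁅x⁆∣≡1;
         x∈⁅x⁆; x∈⁅y⁆⇒x≡y; x∈p∪q⁻; x∈p∪q⁺; x∈p∩q⁺; x∈p∩q⁻; p∩q⊆p; p∩q⊆q;
         x∈p∧x∉q⇒x∈p─q; p─q⊆p; x∈p⇒p-x⊂p; drop-there; s⊆s; out⊆; ∣⊥∣≡0; ∉⊥)
open import Data.Vec using ([]; _∷_; here; there)
open import Data.Vec.Properties using (≡-dec)
open import Data.Bool.Properties using () renaming (_≟_ to _≟ᵇ_)
open import Data.Vec.Functional using (Vector) renaming ([] to []ᵛ; _∷_ to _∷ᵛ_)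
open import Data.Sum using (_⊎_; inj₁; inj₂)
open import Data.Product using (Σ; ∃; _×_; _,_; proj₁; proj₂)
open import Data.Empty using (⊥-elim) renaming (⊥ to Empty)
open import Function using (_∘_)
open import Function.Definitions using (Injective)
open import Algebra.Bundles using (CommutativeRing)
open import Relation.Binary.PropositionalEquality
  using (_≡_; _≢_; refl; sym; trans; cong; cong₂; subst; module ≡-Reasoning)
open import Relation.Nullary using (Dec; yes; no)
open import Relation.Nullary.Decidable using (decidable-stable; _→-dec_)
open import Relation.Nullary.Negation using (¬¬-Monad; ¬¬-map)
open import Effect.Monad using (RawMonad)

private
  variable
    n m k : ℕ

-- Bases, circuits and closures exist only classically; as the theorem is a negation, they are
-- constructed in the double-negation monad.
open RawMonad (¬¬-Monad {0ℓ}) using (_>>=_; pure)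

¬¬-∀-Fin : {P : Fin m → Set} → (∀ i → ¬ ¬ P i) → ¬ ¬ (∀ i → P i)
¬¬-∀-Fin {zero}  _ = pure λ ()
¬¬-∀-Fin {suc m} h = do
  p₀ ← h zero
  ps ← ¬¬-∀-Fin (h ∘ suc)
  pure (∀-cons p₀ ps)

¬¬-∀-Subset : {P : Subset n → Set} → (∀ X → ¬ ¬ P X) → ¬ ¬ (∀ X → P X)
¬¬-∀-Subset {zero}  h = do
  p ← h []
  pure λ { [] → p }
¬¬-∀-Subset {suc n} h = do
  ps ← ¬¬-∀-Subset (h ∘ (inside ∷_))
  qs ← ¬¬-∀-Subset (h ∘ (outside ∷_))
  pure λ { (inside ∷ X) → ps X ; (outside ∷ X) → qs X }

¬¬-→ : {S T : Set} → (S → ¬ ¬ T) → ¬ ¬ (S → T)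
¬¬-→ f ¬[S→T] = ¬[S→T] λ s → ⊥-elim (f s λ t → ¬[S→T] λ _ → t)

Least : {A : Set} → (A → ℕ) → (A → Set) → Set
Least μ P = ∃ λ y → P y × (∀ z → P z → μ y ≤ μ z)

¬¬-least : {A : Set} (μ : A → ℕ) (P : A → Set) {x : A} → P x → ¬ ¬ Least μ P
¬¬-least μ P {x} px no-least = <-rec Q step (μ x) x refl px
  where
  Q : ℕ → Set
  Q m = ∀ y → μ y ≡ m → ¬ P y
  step : ∀ m → (∀ {m′} → m′ < m → Q m′) → Q m
  step _ smaller y refl py = no-least (y , py , λ z pz → ≮⇒≥ λ μz<μy → smaller μz<μy z refl pz)

Largest : (Subset n → Set) → Set
Largest P = ∃ λ Y → P Y × (∀ Z → P Z → ∣ Z ∣ ≤ ∣ Y ∣)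

¬¬-largest : (P : Subset n → Set) {X : Subset n} → P X → ¬ ¬ Largest P
¬¬-largest {n} P pX = do
  (Y , pY , minimal) ← ¬¬-least (λ Y → n ∸ ∣ Y ∣) P pX
  pure (Y , pY , λ Z pZ → ≮⇒≥ λ ∣Y∣<∣Z∣ → <⇒≱ (∸-monoʳ-< ∣Y∣<∣Z∣ (∣p∣≤n Z)) (minimal Z pZ))

infixl 5 _+ₛ_

_+ₛ_ : Subset n → Fin n → Subset n
X +ₛ e = X ∪ ⁅ e ⁆

module _ {X : Subset n} {x e : Fin n} where

  ∈+ₛ⁻ : x ∈ X +ₛ e → x ∈ X ⊎ x ≡ e
  ∈+ₛ⁻ x∈ with x∈p∪q⁻ X ⁅ e ⁆ x∈
  ... | inj₁ x∈X = inj₁ x∈X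
  ... | inj₂ x∈e = inj₂ (x∈⁅y⁆⇒x≡y e x∈e)

  ∉+ₛ : x ∉ X → x ≢ e → x ∉ X +ₛ e
  ∉+ₛ x∉X x≢e x∈ with ∈+ₛ⁻ x∈
  ... | inj₁ x∈X = x∉X x∈X
  ... | inj₂ x≡e = x≢e x≡e

e∈X+ₛe : {X : Subset n} (e : Fin n) → e ∈ X +ₛ e
e∈X+ₛe e = x∈p∪q⁺ (inj₂ (x∈⁅x⁆ e))

X⊆X+ₛe : {X : Subset n} {e : Fin n} → X ⊆ X +ₛ e
X⊆X+ₛe = x∈p∪q⁺ ∘ inj₁

∪-⊆ : {X Y W : Subset n} → X ⊆ W → Y ⊆ W → X ∪ Y ⊆ W
∪-⊆ {X = X} {Y} X⊆W Y⊆W x∈ with x∈p∪q⁻ X Y x∈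
... | inj₁ x∈X = X⊆W x∈X
... | inj₂ x∈Y = Y⊆W x∈Y

+ₛ-⊆ : {X W : Subset n} {e : Fin n} → X ⊆ W → e ∈ W → X +ₛ e ⊆ W
+ₛ-⊆ {e = e} X⊆W e∈W = ∪-⊆ X⊆W λ x∈ → subst (_∈ _) (sym (x∈⁅y⁆⇒x≡y e x∈)) e∈W

+ₛ-mono : {X Y : Subset n} {e : Fin n} → X ⊆ Y → X +ₛ e ⊆ Y +ₛ e
+ₛ-mono X⊆Y = +ₛ-⊆ (X⊆X+ₛe ∘ X⊆Y) (e∈X+ₛe _)

+ₛ-swap : {X : Subset n} {a b : Fin n} → X +ₛ a +ₛ b ⊆ X +ₛ b +ₛ a
+ₛ-swap = +ₛ-⊆ (+ₛ-mono X⊆X+ₛe) (X⊆X+ₛe (e∈X+ₛe _))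

⊆+ₛ-∉ : {X Y : Subset n} {e : Fin n} → Y ⊆ X +ₛ e → e ∉ Y → Y ⊆ X
⊆+ₛ-∉ Y⊆X+e e∉Y x∈Y with ∈+ₛ⁻ (Y⊆X+e x∈Y)
... | inj₁ x∈X = x∈X
... | inj₂ refl = ⊥-elim (e∉Y x∈Y)

X⊆X-e+ₛe : {X : Subset n} {e : Fin n} → X ⊆ X - e +ₛ e
X⊆X-e+ₛe {e = e} {x} x∈X with x ≟ᶠ e
... | yes refl = e∈X+ₛe e
... | no x≢e = X⊆X+ₛe (x∈p∧x∉q⇒x∈p─q x∈X (x≢e ∘ x∈⁅y⁆⇒x≡y e))

∣p∪q∣≤∣p∣+∣q∣ : (p q : Subset n) → ∣ p ∪ q ∣ ≤ ∣ p ∣ + ∣ q ∣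
∣p∪q∣≤∣p∣+∣q∣ [] [] = z≤n
∣p∪q∣≤∣p∣+∣q∣ (inside ∷ p) (inside ∷ q) = s≤s (≤-trans (∣p∪q∣≤∣p∣+∣q∣ p q) (+-monoʳ-≤ ∣ p ∣ (n≤1+n ∣ q ∣)))
∣p∪q∣≤∣p∣+∣q∣ (inside ∷ p) (outside ∷ q) = s≤s (∣p∪q∣≤∣p∣+∣q∣ p q)
∣p∪q∣≤∣p∣+∣q∣ (outside ∷ p) (inside ∷ q) = subst (suc ∣ p ∪ q ∣ ≤_) (sym (+-suc ∣ p ∣ ∣ q ∣)) (s≤s (∣p∪q∣≤∣p∣+∣q∣ p q))
∣p∪q∣≤∣p∣+∣q∣ (outside ∷ p) (outside ∷ q) = ∣p∪q∣≤∣p∣+∣q∣ p q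

∣p∪q∣≡∣p∣+∣q∣ : (p q : Subset n) → (∀ {x} → x ∈ p → x ∉ q) → ∣ p ∪ q ∣ ≡ ∣ p ∣ + ∣ q ∣
∣p∪q∣≡∣p∣+∣q∣ [] [] _ = refl
∣p∪q∣≡∣p∣+∣q∣ (inside ∷ p) (inside ∷ q) disjoint = ⊥-elim (disjoint here here)
∣p∪q∣≡∣p∣+∣q∣ (inside ∷ p) (outside ∷ q) disjoint =
  cong suc (∣p∪q∣≡∣p∣+∣q∣ p q λ x∈p x∈q → disjoint (there x∈p) (there x∈q))
∣p∪q∣≡∣p∣+∣q∣ (outside ∷ p) (inside ∷ q) disjoint =
  trans (cong suc (∣p∪q∣≡∣p∣+∣q∣ p q λ x∈p x∈q → disjoint (there x∈p) (there x∈q))) (sym (+-suc ∣ p ∣ ∣ q ∣))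
∣p∪q∣≡∣p∣+∣q∣ (outside ∷ p) (outside ∷ q) disjoint =
  ∣p∪q∣≡∣p∣+∣q∣ p q λ x∈p x∈q → disjoint (there x∈p) (there x∈q)

∣X+ₛe∣≡1+∣X∣ : {X : Subset n} {e : Fin n} → e ∉ X → ∣ X +ₛ e ∣ ≡ suc ∣ X ∣
∣X+ₛe∣≡1+∣X∣ {X = X} {e} e∉X = begin
  ∣ X ∪ ⁅ e ⁆ ∣       ≡⟨ ∣p∪q∣≡∣p∣+∣q∣ X ⁅ e ⁆ (λ x∈X x∈e → e∉X (subst (_∈ X) (x∈⁅y⁆⇒x≡y e x∈e) x∈X)) ⟩
  ∣ X ∣ + ∣ ⁅ e ⁆ ∣   ≡⟨ cong (∣ X ∣ +_) (∣⁅x⁆∣≡1 e) ⟩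
  ∣ X ∣ + 1           ≡⟨ +-comm ∣ X ∣ 1 ⟩
  suc ∣ X ∣           ∎
  where open ≡-Reasoning

∣X∣<∣X+ₛe∣ : {X : Subset n} {e : Fin n} → e ∉ X → ∣ X ∣ < ∣ X +ₛ e ∣
∣X∣<∣X+ₛe∣ e∉X = ≤-reflexive (sym (∣X+ₛe∣≡1+∣X∣ e∉X))

∣X+ₛe∣≤1+∣X∣ : (X : Subset n) (e : Fin n) → ∣ X +ₛ e ∣ ≤ suc ∣ X ∣
∣X+ₛe∣≤1+∣X∣ X e = ≤-trans (∣p∪q∣≤∣p∣+∣q∣ X ⁅ e ⁆) (≤-reflexive (trans (cong (∣ X ∣ +_) (∣⁅x⁆∣≡1 e)) (+-comm ∣ X ∣ 1)))

⊈⇒∃∉ : {X Y : Subset n} → X ⊈ Y → ∃ λ x → x ∈ X × x ∉ Y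
⊈⇒∃∉ {n} {X} {Y} X⊈Y with ¬∀⟶∃¬ n (λ x → x ∈ X → x ∈ Y) (λ x → x ∈? X →-dec x ∈? Y) (λ h → X⊈Y (h _))
... | x , ¬[x∈X→x∈Y] with x ∈? X
...   | yes x∈X = x , x∈X , ¬[x∈X→x∈Y] ∘ (λ x∈Y _ → x∈Y)
...   | no x∉X = ⊥-elim (¬[x∈X→x∈Y] (⊥-elim ∘ x∉X))

⊆∧≢⇒⊂ : {X Y : Subset n} → X ⊆ Y → X ≢ Y → X ⊂ Y
⊆∧≢⇒⊂ X⊆Y X≢Y = X⊆Y , ⊈⇒∃∉ (X≢Y ∘ ⊆-antisym X⊆Y)

∃⊂-of-size : (S : Subset n) → k < ∣ S ∣ → ∃ λ T → T ⊆ S × ∣ T ∣ ≡ k × ∃ λ e → e ∈ S × e ∉ T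
∃⊂-of-size [] ()
∃⊂-of-size (outside ∷ S) k<∣S∣ with ∃⊂-of-size S k<∣S∣
... | T , T⊆S , ∣T∣≡k , e , e∈S , e∉T = outside ∷ T , out⊆ T⊆S , ∣T∣≡k , suc e , there e∈S , e∉T ∘ drop-there
∃⊂-of-size {n = suc n} {k = zero} (inside ∷ S) _ = ⊥ , ⊆-min _ , ∣⊥∣≡0 (suc n) , zero , here , ∉⊥
∃⊂-of-size {k = suc k} (inside ∷ S) (s≤s k<∣S∣) with ∃⊂-of-size S k<∣S∣
... | T , T⊆S , ∣T∣≡k , e , e∈S , e∉T = inside ∷ T , s⊆s T⊆S , cong suc ∣T∣≡k , suc e , there e∈S , e∉T ∘ drop-there

x∈p─q⇒x∉q : {x : Fin n} (p q : Subset n) → x ∈ p ─ q → x ∉ q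
x∈p─q⇒x∉q (inside  ∷ p) (inside ∷ q) () here
x∈p─q⇒x∉q (outside ∷ p) (inside ∷ q) () here
x∈p─q⇒x∉q (_ ∷ p) (_ ∷ q) (there x∈p─q) (there x∈q) = x∈p─q⇒x∉q p q x∈p─q x∈q

∉∪ : {X Y : Subset n} {x : Fin n} → x ∉ X → x ∉ Y → x ∉ X ∪ Y
∉∪ {X = X} {Y} x∉X x∉Y x∈X∪Y with x∈p∪q⁻ X Y x∈X∪Y
... | inj₁ x∈X = x∉X x∈X
... | inj₂ x∈Y = x∉Y x∈Y

∷ᵛ-injective : {A : Set} {P : A → Set} {x : A} {f : Vector A m} →
               ¬ P x → (∀ i → P (f i)) → Injective _≡_ _≡_ f → Injective _≡_ _≡_ (x ∷ᵛ f)
∷ᵛ-injective _ _ _ {zero} {zero} _ = refl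
∷ᵛ-injective {P = P} ¬Px Pf _ {zero} {suc j} x≡fj = ⊥-elim (¬Px (subst P (sym x≡fj) (Pf j)))
∷ᵛ-injective {P = P} ¬Px Pf _ {suc i} {zero} fi≡x = ⊥-elim (¬Px (subst P fi≡x (Pf i)))
∷ᵛ-injective _ _ f-injective {suc i} {suc j} fi≡fj = cong suc (f-injective fi≡fj)

[_]-injective : {A : Set} (a : A) → Injective _≡_ _≡_ (a ∷ᵛ []ᵛ)
[ _ ]-injective {zero}  {zero}  _ = refl
[ _ ]-injective {suc ()}
[ _ ]-injective {_} {suc ()}

chain-maximum : (f : Fin (suc m) → Subset n) → (∀ i j → f i ⊆ f j ⊎ f j ⊆ f i) → ∃ λ i → ∀ j → f j ⊆ f i
chain-maximum {zero}  f _ = zero , λ { zero → ⊆-refl }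
chain-maximum {suc m} f comparable with chain-maximum (f ∘ suc) (λ i j → comparable (suc i) (suc j))
... | i , tail⊆f[1+i] with comparable zero (suc i)
...   | inj₁ f0⊆f[1+i] = suc i , λ { zero → f0⊆f[1+i] ; (suc j) → tail⊆f[1+i] j }
...   | inj₂ f[1+i]⊆f0 = zero , λ { zero → ⊆-refl ; (suc j) → ⊆-trans (tail⊆f[1+i] j) f[1+i]⊆f0 }

avoiding⇒¬injective : (z : Fin m) (f : Fin m → Fin m) → (∀ i → f i ≢ z) → ¬ Injective _≡_ _≡_ f
avoiding⇒¬injective {suc m} z f f≢z f-injective =
  1+n≰n (injective⇒≤ {f = λ i → punchOut (f≢z i ∘ sym)}
                      λ {i} {j} → f-injective ∘ punchOut-injective (f≢z i ∘ sym) (f≢z j ∘ sym))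

_≟ₛ_ : (X Y : Subset n) → Dec (X ≡ Y)
_≟ₛ_ = ≡-dec _≟ᵇ_

-- Bases, circuits and flats

module _ {n : ℕ} (M : Matroid n) where
  open Matroid M

  private
    variable
      B I K X Y W F : Subset n
      e : Fin n
      r r′ : ℕ

  IsBasis : Subset n → Subset n → Set
  IsBasis X B = B ⊆ X × Indep B × (∀ J → J ⊆ X → Indep J → ∣ J ∣ ≤ ∣ B ∣)

  basis⇒rank : IsBasis X B → HasRank M X ∣ B ∣
  basis⇒rank (B⊆X , iB , largest) = (_ , B⊆X , iB , refl) , largest

  rank-unique : HasRank M X r → HasRank M X r′ → r ≡ r′
  rank-unique ((I , I⊆X , iI , refl) , bound) ((I′ , I′⊆X , iI′ , refl) , bound′) =
    ≤-antisym (bound′ I I⊆X iI) (bound I′ I′⊆X iI′)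

  rank<⇒dependent : HasRank M X r → Y ⊆ X → r < ∣ Y ∣ → ¬ Indep Y
  rank<⇒dependent (_ , bound) Y⊆X r<∣Y∣ iY = <⇒≱ r<∣Y∣ (bound _ Y⊆X iY)

  maximal⇒basis : B ⊆ X → Indep B → (∀ e → e ∈ X → e ∉ B → ¬ Indep (B +ₛ e)) → IsBasis X B
  maximal⇒basis B⊆X iB maximal = B⊆X , iB , λ J J⊆X iJ → ≮⇒≥ λ ∣B∣<∣J∣ →
    let (e , e∈J , e∉B , iB+e) = indep-aug iB iJ ∣B∣<∣J∣ in maximal e (J⊆X e∈J) e∉B iB+e

  ¬¬-basis-⊇ : Indep I → I ⊆ X → ¬ ¬ (∃ λ B → I ⊆ B × IsBasis X B)
  ¬¬-basis-⊇ {I} {X} iI I⊆X = ¬¬-map largest⇒basis (¬¬-largest Independent⊇I (⊆-refl , I⊆X , iI))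
    where
    Independent⊇I : Subset n → Set
    Independent⊇I J = I ⊆ J × J ⊆ X × Indep J
    largest⇒basis : Largest Independent⊇I → ∃ λ B → I ⊆ B × IsBasis X B
    largest⇒basis (B , (I⊆B , B⊆X , iB) , largest) = B , I⊆B , maximal⇒basis B⊆X iB λ e e∈X e∉B iB+e →
      <⇒≱ (∣X∣<∣X+ₛe∣ e∉B) (largest (B +ₛ e) (⊆-trans I⊆B X⊆X+ₛe , +ₛ-⊆ B⊆X e∈X , iB+e))

  ¬¬-rank : ∀ X → ¬ ¬ (∃ (HasRank M X))
  ¬¬-rank X = do
    (B , _ , basis) ← ¬¬-basis-⊇ indep-⊥ (⊆-min X)
    pure (∣ B ∣ , basis⇒rank basis)

  minimal-dependent⇒circuit : ¬ Indep K → (∀ D → D ⊆ K → ¬ Indep D → ∣ K ∣ ≤ ∣ D ∣) → ¬ ¬ IsCircuit M K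
  minimal-dependent⇒circuit {C} ¬iC smallest = do
    proper ← ¬¬-∀-Subset λ D → ¬¬-→ λ (D⊆C : D ⊆ C) → ¬¬-→ λ D≢C ¬iD →
      <⇒≱ (p⊂q⇒∣p∣<∣q∣ (⊆∧≢⇒⊂ D⊆C D≢C)) (smallest D D⊆C ¬iD)
    pure (¬iC , proper)

  ¬¬-circuit-⊆ : ¬ Indep X → ¬ ¬ (∃ λ C → IsCircuit M C × C ⊆ X)
  ¬¬-circuit-⊆ {X} ¬iX = do
    (C , (C⊆X , ¬iC) , smallest) ← ¬¬-least ∣_∣ (λ D → D ⊆ X × ¬ Indep D) (⊆-refl , ¬iX)
    circuit ← minimal-dependent⇒circuit ¬iC λ D D⊆C ¬iD → smallest D (⊆-trans D⊆C C⊆X , ¬iD)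
    pure (C , circuit , λ {x} → C⊆X {x})

  CircuitThrough : Fin n → Subset n → Set
  CircuitThrough e X = ∃ λ C → IsCircuit M C × C ⊆ X × e ∈ C

  circuitThrough-mono : X ⊆ Y → CircuitThrough e X → CircuitThrough e Y
  circuitThrough-mono X⊆Y (C , circuit , C⊆X , e∈C) = C , circuit , ⊆-trans C⊆X X⊆Y , e∈C

  circuit⇒cyclic : IsCircuit M K → IsUnionOfCircuits M K
  circuit⇒cyclic circuit e e∈C = _ , circuit , ⊆-refl , e∈C

  ¬¬-fundamental-circuit : Indep B → ¬ Indep (B +ₛ e) → ¬ ¬ CircuitThrough e (B +ₛ e)
  ¬¬-fundamental-circuit {B} {e} iB ¬iB+e = ¬¬-map through-e (¬¬-circuit-⊆ ¬iB+e)
    where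
    through-e : (∃ λ C → IsCircuit M C × C ⊆ B +ₛ e) → CircuitThrough e (B +ₛ e)
    through-e (C , circuit , C⊆B+e) =
      C , circuit , C⊆B+e , decidable-stable (e ∈? C) λ e∉C → proj₁ circuit (indep-⊆ iB (⊆+ₛ-∉ C⊆B+e e∉C))

  circuit-rank : IsCircuit M K → HasRank M K r → suc r ≡ ∣ K ∣
  circuit-rank {C} (¬iC , proper) ((I , I⊆C , iI , refl) , bound)
    with ⊆∧≢⇒⊂ I⊆C (λ I≡C → ¬iC (subst Indep I≡C iI))
  ... | I⊂C@(_ , c , c∈C , _) = ≤-antisym (p⊂q⇒∣p∣<∣q∣ I⊂C) (begin
    ∣ C ∣           ≤⟨ p⊆q⇒∣p∣≤∣q∣ (X⊆X-e+ₛe {X = C} {c}) ⟩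
    ∣ C - c +ₛ c ∣  ≤⟨ ∣X+ₛe∣≤1+∣X∣ (C - c) c ⟩
    suc ∣ C - c ∣   ≤⟨ s≤s (bound (C - c) C-c⊆C (proper (C - c) C-c⊆C λ eq → ⊂-irref eq C-c⊂C)) ⟩
    suc ∣ I ∣       ∎)
    where
    open ≤-Reasoning
    C-c⊂C = x∈p⇒p-x⊂p c∈C
    C-c⊆C = proj₁ C-c⊂C

  basis-+ₛ-dependent : IsBasis F B → ¬ Indep (B +ₛ e) → IsBasis (F +ₛ e) B
  basis-+ₛ-dependent {F} {B} {e} (B⊆F , iB , largest) ¬iB+e = maximal⇒basis (⊆-trans B⊆F X⊆X+ₛe) iB maximal
    where
    maximal : ∀ x → x ∈ F +ₛ e → x ∉ B → ¬ Indep (B +ₛ x)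
    maximal x x∈F+e x∉B iB+x with ∈+ₛ⁻ x∈F+e
    ... | inj₁ x∈F = <⇒≱ (∣X∣<∣X+ₛe∣ x∉B) (largest _ (+ₛ-⊆ B⊆F x∈F) iB+x)
    ... | inj₂ refl = ¬iB+e iB+x

  flat-closed : IsFlat M F → IsBasis F B → ¬ Indep (B +ₛ e) → e ∈ F
  flat-closed {F} {B} {e} flat basis ¬iB+e = decidable-stable (e ∈? F) λ e∉F →
    flat e e∉F ∣ B ∣ (basis⇒rank basis) (basis⇒rank (basis-+ₛ-dependent basis ¬iB+e))

  span⊆flat : IsFlat M F → X ⊆ F → X ⊆ W → HasRank M X r → HasRank M W r → W ⊆ F
  span⊆flat {F} {X} {W} flat X⊆F X⊆W ((I , I⊆X , iI , refl) , _) rankW {e} e∈W =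
    decidable-stable (e ∈? F) λ e∉F → ¬¬-basis-⊇ iI (⊆-trans I⊆X X⊆F) λ (B , I⊆B , basis) →
      e∉F (flat-closed flat basis λ iB+e → rank<⇒dependent rankW (+ₛ-⊆ (⊆-trans I⊆X X⊆W) e∈W)
                                             (∣X∣<∣X+ₛe∣ (e∉F ∘ X⊆F ∘ I⊆X)) (indep-⊆ iB+e (+ₛ-mono I⊆B)))

  flat-rank-< : IsFlat M Y → Y ⊂ W → HasRank M Y r → HasRank M W r′ → r < r′
  flat-rank-< {Y} {W} {r} {r′} flat (Y⊆W , e , e∈W , e∉Y) rankY@((I , I⊆Y , iI , ∣I∣≡r) , _) (_ , boundW) =
    decidable-stable (r <? r′) λ r≮r′ → flat e e∉Y r rankY
      ((I , ⊆-trans I⊆Y X⊆X+ₛe , iI , ∣I∣≡r) ,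
       λ J J⊆Y+e iJ → ≤-trans (boundW J (⊆-trans J⊆Y+e (+ₛ-⊆ Y⊆W e∈W)) iJ) (≮⇒≥ r≮r′))

  spanned-by-cyclic : IsUnionOfCircuits M X → HasRank M X r → X ⊆ W → HasRank M W r →
                      ∀ e → e ∈ W → ¬ ¬ CircuitThrough e W
  spanned-by-cyclic {X} cyclic ((I , I⊆X , iI , refl) , _) X⊆W rankW e e∈W with e ∈? X
  ... | yes e∈X = pure (circuitThrough-mono X⊆W (cyclic e e∈X))
  ... | no e∉X  = ¬¬-map (circuitThrough-mono I+e⊆W) (¬¬-fundamental-circuit iI ¬iI+e)
    where
    I+e⊆W = +ₛ-⊆ (⊆-trans I⊆X X⊆W) e∈W
    ¬iI+e = rank<⇒dependent rankW I+e⊆W (∣X∣<∣X+ₛe∣ (e∉X ∘ I⊆X))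

  maximal-span⇒flat : HasRank M W r → (∀ e → e ∉ W → ¬ HasRank M (W +ₛ e) r) → IsFlat M W
  maximal-span⇒flat {W} rankW maximal e e∉W r′ rankW′ rankW+e =
    maximal e e∉W (subst (HasRank M (W +ₛ e)) (rank-unique rankW′ rankW) rankW+e)

  record CyclicClosure (X : Subset n) (r : ℕ) : Set where
    constructor cyclicClosure
    field
      closure      : Subset n
      X⊆closure    : X ⊆ closure
      rank-closure : HasRank M closure r
      cyclic-flat  : IsCyclicFlat M closure

  ¬¬-cyclicClosure : IsUnionOfCircuits M X → HasRank M X r → ¬ ¬ CyclicClosure X r
  ¬¬-cyclicClosure {X} {r} cyclic rankX = do
    (W , (X⊆W , rankW) , largest) ← ¬¬-largest (λ W → X ⊆ W × HasRank M W r) (⊆-refl , rankX)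
    cyclicW ← ¬¬-∀-Fin λ e → ¬¬-→ (spanned-by-cyclic cyclic rankX X⊆W rankW e)
    let flatW = maximal-span⇒flat rankW λ e e∉W rankW+e →
                  <⇒≱ (∣X∣<∣X+ₛe∣ e∉W) (largest (W +ₛ e) (⊆-trans X⊆W X⊆X+ₛe , rankW+e))
    pure (cyclicClosure W X⊆W rankW (flatW , cyclicW))

  -- Consecutive cyclic flats

  -- Z′ is the largest cyclic flat strictly inside Z; when Z(M) is a chain, Z′ is covered by Z.
  record _⋖_ (Z′ Z : Subset n) : Set where
    field
      cyclic-lower    : IsCyclicFlat M Z′
      cyclic-upper    : IsCyclicFlat M Z
      lower⊂upper     : Z′ ⊂ Z
      nothing-between : ∀ W → IsCyclicFlat M W → W ⊆ Z → W ⊈ Z′ → W ≡ Z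

  ¬¬-predecessor : CyclicFlatsChain M → IsCyclicFlat M Y → IsCyclicFlat M W → Y ⊂ W →
                   ¬ ¬ (∃ λ Z′ → Y ⊆ Z′ × Z′ ⋖ W)
  ¬¬-predecessor {Y} {Z} chain cyclicY cyclicZ Y⊂Z =
    ¬¬-map largest⇒cover (¬¬-largest Between (cyclicY , ⊆-refl , Y⊂Z))
    where
    Between : Subset n → Set
    Between W = IsCyclicFlat M W × Y ⊆ W × W ⊂ Z
    largest⇒cover : Largest Between → ∃ λ Z′ → Y ⊆ Z′ × Z′ ⋖ Z
    largest⇒cover (Z′ , (cyclicZ′ , Y⊆Z′ , Z′⊂Z) , largest) = Z′ , Y⊆Z′ , record
      { cyclic-lower = cyclicZ′ ; cyclic-upper = cyclicZ ; lower⊂upper = Z′⊂Z ; nothing-between = nothing-between }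
      where
      nothing-between : ∀ W → IsCyclicFlat M W → W ⊆ Z → W ⊈ Z′ → W ≡ Z
      nothing-between W cyclicW W⊆Z W⊈Z′ = decidable-stable (W ≟ₛ Z) (comparable (chain Z′ W cyclicZ′ cyclicW))
        where
        comparable : Z′ ⊆ W ⊎ W ⊆ Z′ → ¬ W ≢ Z
        comparable (inj₂ W⊆Z′) _ = W⊈Z′ W⊆Z′
        comparable (inj₁ Z′⊆W) W≢Z = <⇒≱ (p⊂q⇒∣p∣<∣q∣ (Z′⊆W , ⊈⇒∃∉ W⊈Z′))
                                         (largest W (cyclicW , ⊆-trans Y⊆Z′ Z′⊆W , ⊆∧≢⇒⊂ W⊆Z W≢Z))

  -- Contracting C, the points form a U_{2,m} minor of M|Z.
  record LineConfig (Z : Subset n) (m : ℕ) : Set where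
    field
      rank            : ℕ
      rank-Z          : HasRank M Z rank
      C               : Subset n
      point           : Fin m → Fin n
      C⊆Z             : C ⊆ Z
      point∈Z         : ∀ i → point i ∈ Z
      point∉C         : ∀ i → point i ∉ C
      point-injective : Injective _≡_ _≡_ point
      rank≡2+∣C∣      : rank ≡ 2 + ∣ C ∣
      pair-indep      : ∀ {i j} → i ≢ j → Indep (C +ₛ point i +ₛ point j)

    triple-dependent : ∀ {i j k} → i ≢ j → i ≢ k → j ≢ k → ¬ Indep (C +ₛ point i +ₛ point j +ₛ point k)
    triple-dependent {i} {j} {k} i≢j i≢k j≢k =
      rank<⇒dependent rank-Z (+ₛ-⊆ (+ₛ-⊆ (+ₛ-⊆ C⊆Z (point∈Z i)) (point∈Z j)) (point∈Z k)) (≤-reflexive (begin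
        suc rank                                 ≡⟨ cong suc rank≡2+∣C∣ ⟩
        suc (suc (suc ∣ C ∣))                    ≡˘⟨ cong (2 +_) (∣X+ₛe∣≡1+∣X∣ (point∉C i)) ⟩
        suc (suc ∣ C +ₛ point i ∣)               ≡˘⟨ cong suc (∣X+ₛe∣≡1+∣X∣ pⱼ∉C+pᵢ) ⟩
        suc ∣ C +ₛ point i +ₛ point j ∣          ≡˘⟨ ∣X+ₛe∣≡1+∣X∣ pₖ∉C+pᵢ+pⱼ ⟩
        ∣ C +ₛ point i +ₛ point j +ₛ point k ∣   ∎))
      where
      open ≡-Reasoning
      distinct : ∀ {i j} → i ≢ j → point i ≢ point j
      distinct i≢j = i≢j ∘ point-injective
      pⱼ∉C+pᵢ = ∉+ₛ (point∉C j) (distinct (i≢j ∘ sym))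
      pₖ∉C+pᵢ+pⱼ = ∉+ₛ (∉+ₛ (point∉C k) (distinct (i≢k ∘ sym))) (distinct (j≢k ∘ sym))

  point-indep : (L : LineConfig W (2 + m)) → ∀ i → Indep (LineConfig.C L +ₛ LineConfig.point L i)
  point-indep L i = indep-⊆ (pair-indep (i≢other i)) X⊆X+ₛe
    where
    open LineConfig L
    other : Fin (2 + _) → Fin (2 + _)
    other zero    = suc zero
    other (suc _) = zero
    i≢other : ∀ i → i ≢ other i
    i≢other zero    ()
    i≢other (suc _) ()

  module _ {Z′ Z : Subset n} (cover : Z′ ⋖ Z) where
    open _⋖_ cover

    ⋖-below : IsCyclicFlat M W → W ⊂ Z → W ⊆ Z′
    ⋖-below {W} cyclicW W⊂Z with W ⊆? Z′
    ... | yes W⊆Z′ = W⊆Z′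
    ... | no W⊈Z′ = ⊥-elim (⊂-irref (nothing-between W cyclicW (proj₁ W⊂Z) W⊈Z′) W⊂Z)

    ⋖-circuit-size : HasRank M Z r → IsCircuit M K → K ⊆ Z → K ⊈ Z′ → suc r ≡ ∣ K ∣
    -- The cyclic closure of C lies in the flat Z but not in Z′, so it is Z, and r(C) = r(Z).
    ⋖-circuit-size {r} {C} rankZ circuit C⊆Z C⊈Z′ = decidable-stable (suc r ≟ ∣ C ∣) do
      (k , rankC) ← ¬¬-rank C
      cyclicClosure W C⊆W rankW cyclicW ← ¬¬-cyclicClosure (circuit⇒cyclic circuit) rankC
      let W≡Z = nothing-between W cyclicW (span⊆flat (proj₁ cyclic-upper) C⊆Z C⊆W rankC rankW)
                                (λ W⊆Z′ → C⊈Z′ (⊆-trans C⊆W W⊆Z′))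
      pure (trans (cong suc (rank-unique rankZ (subst (λ W → HasRank M W k) W≡Z rankW))) (circuit-rank circuit rankC))

    ⋖-indep : HasRank M Z r → X ⊆ Z → ∣ X ∣ ≤ r → X ∩ Z′ ⊆ I → Indep I → ¬ ¬ Indep X
    ⋖-indep {r} {X} rankZ X⊆Z ∣X∣≤r X∩Z′⊆I iI ¬iX = ¬¬-circuit-⊆ ¬iX refute
      where
      refute : ¬ (∃ λ C → IsCircuit M C × C ⊆ X)
      refute (C , circuit , C⊆X) with C ⊆? Z′
      ... | yes C⊆Z′ = proj₁ circuit (indep-⊆ iI λ x∈C → X∩Z′⊆I (x∈p∩q⁺ (C⊆X x∈C , C⊆Z′ x∈C)))
      ... | no C⊈Z′ = 1+n≰n (begin
        suc r  ≡⟨ ⋖-circuit-size rankZ circuit (⊆-trans C⊆X X⊆Z) C⊈Z′ ⟩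
        ∣ C ∣  ≤⟨ p⊆q⇒∣p∣≤∣q∣ C⊆X ⟩
        ∣ X ∣  ≤⟨ ∣X∣≤r ⟩
        r      ∎)
        where open ≤-Reasoning

    ⋖-nullity : HasRank M Z r → HasRank M Z′ r′ → suc r ≤ r′ + ∣ Z ─ Z′ ∣
    ⋖-nullity {r} {r′} rankZ (_ , boundZ′) with lower⊂upper
    ... | _ , x , x∈Z , x∉Z′ with proj₂ cyclic-upper x x∈Z
    ...   | C , circuit , C⊆Z , x∈C = begin
      suc r                    ≡⟨ ⋖-circuit-size rankZ circuit C⊆Z (λ C⊆Z′ → x∉Z′ (C⊆Z′ x∈C)) ⟩
      ∣ C ∣                    ≤⟨ p⊆q⇒∣p∣≤∣q∣ C⊆ ⟩
      ∣ C ∩ Z′ ∪ (Z ─ Z′) ∣      ≤⟨ ∣p∪q∣≤∣p∣+∣q∣ (C ∩ Z′) (Z ─ Z′) ⟩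
      ∣ C ∩ Z′ ∣ + ∣ Z ─ Z′ ∣  ≤⟨ +-monoˡ-≤ ∣ Z ─ Z′ ∣ (boundZ′ (C ∩ Z′) (p∩q⊆q C Z′) iC∩Z′) ⟩
      r′ + ∣ Z ─ Z′ ∣          ∎
      where
      open ≤-Reasoning
      iC∩Z′ : Indep (C ∩ Z′)
      iC∩Z′ = proj₂ circuit (C ∩ Z′) (p∩q⊆p C Z′) λ C∩Z′≡C →
        x∉Z′ (proj₂ (x∈p∩q⁻ C Z′ (subst (x ∈_) (sym C∩Z′≡C) x∈C)))
      C⊆ : C ⊆ C ∩ Z′ ∪ (Z ─ Z′)
      C⊆ {y} y∈C with y ∈? Z′
      ... | yes y∈Z′ = x∈p∪q⁺ (inj₁ (x∈p∩q⁺ (y∈C , y∈Z′)))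
      ... | no y∉Z′ = x∈p∪q⁺ (inj₂ (x∈p∧x∉q⇒x∈p─q (C⊆Z y∈C) y∉Z′))

    ⋖-room : HasRank M Z r → HasRank M Z′ r′ → ∃ λ d → r ≡ suc r′ + d × suc (suc d) ≤ ∣ Z ─ Z′ ∣
    ⋖-room {r} {r′} rankZ rankZ′ with m≤n⇒∃[o]m+o≡n (flat-rank-< (proj₁ cyclic-lower) lower⊂upper rankZ′ rankZ)
    ... | d , 1+r′+d≡r = d , sym 1+r′+d≡r , +-cancelˡ-≤ r′ _ _ (begin
      r′ + suc (suc d)  ≡⟨ +-suc r′ (suc d) ⟩
      suc (r′ + suc d)  ≡⟨ cong suc (+-suc r′ d) ⟩
      suc (suc r′ + d)  ≡⟨ cong suc 1+r′+d≡r ⟩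
      suc r             ≤⟨ ⋖-nullity rankZ rankZ′ ⟩
      r′ + ∣ Z ─ Z′ ∣   ∎)
      where open ≤-Reasoning

    private
      Z′⊆Z : Z′ ⊆ Z
      Z′⊆Z = proj₁ lower⊂upper

      new∉Z′ : ∀ {x} → x ∈ Z ─ Z′ → x ∉ Z′
      new∉Z′ = x∈p─q⇒x∉q Z Z′

      ∪-new-⊆ : ∀ {C T} → C ⊆ Z′ → T ⊆ Z ─ Z′ → C ∪ T ⊆ Z
      ∪-new-⊆ C⊆Z′ T⊆S = ∪-⊆ (⊆-trans C⊆Z′ Z′⊆Z) (⊆-trans T⊆S (p─q⊆p Z Z′))

      ∣∪-new∣ : ∀ {C T} → C ⊆ Z′ → T ⊆ Z ─ Z′ → ∣ C ∪ T ∣ ≡ ∣ C ∣ + ∣ T ∣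
      ∣∪-new∣ {C} {T} C⊆Z′ T⊆S = ∣p∪q∣≡∣p∣+∣q∣ C T λ x∈C x∈T → new∉Z′ (T⊆S x∈T) (C⊆Z′ x∈C)

    ⋖-lift-pair : ∀ {C T a b} → HasRank M Z r → C ⊆ Z′ → T ⊆ Z ─ Z′ → r ≡ 2 + ∣ C ∪ T ∣ → a ∈ Z → b ∈ Z →
                  Indep I → C ⊆ I → (a ∈ Z′ → a ∈ I) → (b ∈ Z′ → b ∈ I) → ¬ ¬ Indep (C ∪ T +ₛ a +ₛ b)
    ⋖-lift-pair {r} {I} {C} {T} {a} {b} rankZ C⊆Z′ T⊆S r≡ a∈Z b∈Z iI C⊆I a∈I b∈I =
      ⋖-indep rankZ X⊆Z ∣X∣≤r trace iI
      where
      X⊆Z : C ∪ T +ₛ a +ₛ b ⊆ Z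
      X⊆Z = +ₛ-⊆ (+ₛ-⊆ (∪-new-⊆ C⊆Z′ T⊆S) a∈Z) b∈Z
      ∣X∣≤r : ∣ C ∪ T +ₛ a +ₛ b ∣ ≤ r
      ∣X∣≤r = ≤-trans (∣X+ₛe∣≤1+∣X∣ (C ∪ T +ₛ a) b) (≤-trans (s≤s (∣X+ₛe∣≤1+∣X∣ (C ∪ T) a)) (≤-reflexive (sym r≡)))
      trace : (C ∪ T +ₛ a +ₛ b) ∩ Z′ ⊆ I
      trace x∈ with x∈p∩q⁻ _ Z′ x∈
      ... | x∈X , x∈Z′ with ∈+ₛ⁻ x∈X
      ... | inj₂ refl = b∈I x∈Z′
      ... | inj₁ x∈X′ with ∈+ₛ⁻ x∈X′
      ...   | inj₂ refl = a∈I x∈Z′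
      ...   | inj₁ x∈C∪T with x∈p∪q⁻ C T x∈C∪T
      ...     | inj₁ x∈C = C⊆I x∈C
      ...     | inj₂ x∈T = ⊥-elim (new∉Z′ (T⊆S x∈T) x∈Z′)

    ¬¬-LineConfig₃ : HasRank M Z′ (suc k) → ¬ ¬ LineConfig Z 3
    ¬¬-LineConfig₃ {k} rankZ′@((I , I⊆Z′ , iI , ∣I∣≡1+k) , _) = do
      (r , rankZ) ← ¬¬-rank Z
      extend r rankZ (⋖-room rankZ rankZ′)
      where
      extend : ∀ r → HasRank M Z r → (∃ λ d → r ≡ suc (suc k) + d × suc (suc d) ≤ ∣ Z ─ Z′ ∣) → ¬ ¬ LineConfig Z 3
      extend r rankZ (d , r≡ , room) with ∃⊂-of-size I (≤-reflexive (sym ∣I∣≡1+k)) | ∃⊂-of-size (Z ─ Z′) room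
      ... | C , C⊆I , ∣C∣≡k , p , p∈I , p∉C | T , T⊆S , ∣T∣≡1+d , e , e∈S , e∉T
          with ∃⊂-of-size T (≤-reflexive (sym ∣T∣≡1+d))
      ... | D , D⊆T , ∣D∣≡d , e′ , e′∈T , e′∉D = do
        pairs ← ¬¬-∀-Fin λ i → ¬¬-∀-Fin λ j → ¬¬-→ λ _ →
          ⋖-lift-pair rankZ C⊆Z′ D⊆S r≡2+∣C∪D∣ (point∈Z i) (point∈Z j) iC+p X⊆X+ₛe (trace i) (trace j)
        pure record
          { rank = r ; rank-Z = rankZ ; C = C ∪ D ; point = point
          ; C⊆Z = ∪-new-⊆ C⊆Z′ D⊆S ; point∈Z = point∈Z ; point∉C = point∉C∪D
          ; point-injective = ∷ᵛ-injective {P = _∉ T} (λ e′∉T → e′∉T e′∈T) (∀-cons e∉T (∀-cons (new∉T p∈Z′) λ ()))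
                                (∷ᵛ-injective {P = _∈ Z′} (new∉Z′ e∈S) (∀-cons p∈Z′ λ ()) [ p ]-injective)
          ; rank≡2+∣C∣ = r≡2+∣C∪D∣ ; pair-indep = λ {i} {j} → pairs i j }
        where
        C⊆Z′ = ⊆-trans C⊆I I⊆Z′
        p∈Z′ = I⊆Z′ p∈I
        D⊆S = ⊆-trans D⊆T T⊆S
        new∉T : ∀ {x} → x ∈ Z′ → x ∉ T
        new∉T x∈Z′ x∈T = new∉Z′ (T⊆S x∈T) x∈Z′
        iC+p : Indep (C +ₛ p)
        iC+p = indep-⊆ iI (+ₛ-⊆ C⊆I p∈I)
        point : Fin 3 → Fin n
        point = e′ ∷ᵛ e ∷ᵛ p ∷ᵛ []ᵛ
        point∈Z : ∀ i → point i ∈ Z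
        point∈Z = ∀-cons (p─q⊆p Z Z′ (T⊆S e′∈T)) (∀-cons (p─q⊆p Z Z′ e∈S) (∀-cons (Z′⊆Z p∈Z′) λ ()))
        trace : ∀ i → point i ∈ Z′ → point i ∈ C +ₛ p
        trace zero                e′∈Z′ = ⊥-elim (new∉Z′ (T⊆S e′∈T) e′∈Z′)
        trace (suc zero)          e∈Z′  = ⊥-elim (new∉Z′ e∈S e∈Z′)
        trace (suc (suc zero))    _     = e∈X+ₛe p
        point∉C∪D : ∀ i → point i ∉ C ∪ D
        point∉C∪D = ∀-cons (∉∪ (new∉Z′ (T⊆S e′∈T) ∘ C⊆Z′) e′∉D)
                   (∀-cons (∉∪ (new∉Z′ e∈S ∘ C⊆Z′) (e∉T ∘ D⊆T))
                   (∀-cons (∉∪ p∉C (new∉T p∈Z′ ∘ D⊆T)) λ ()))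
        r≡2+∣C∪D∣ : r ≡ 2 + ∣ C ∪ D ∣
        r≡2+∣C∪D∣ = begin
          r                    ≡⟨ r≡ ⟩
          2 + k + d            ≡˘⟨ cong (λ x → 2 + k + x) ∣D∣≡d ⟩
          2 + (k + ∣ D ∣)      ≡˘⟨ cong (λ x → 2 + (x + ∣ D ∣)) ∣C∣≡k ⟩
          2 + (∣ C ∣ + ∣ D ∣)  ≡˘⟨ cong (2 +_) (∣∪-new∣ C⊆Z′ D⊆S) ⟩
          2 + ∣ C ∪ D ∣        ∎
          where open ≡-Reasoning

    ¬¬-LineConfig-suc : LineConfig Z′ (2 + m) → ¬ ¬ LineConfig Z (3 + m)
    ¬¬-LineConfig-suc {m} L = do
      (r , rankZ) ← ¬¬-rank Z
      extend r rankZ (⋖-room rankZ rank-Z)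
      where
      open LineConfig L renaming (C⊆Z to C⊆Z′; point∈Z to point∈Z′)
      extend : ∀ r → HasRank M Z r → (∃ λ d → r ≡ suc rank + d × suc (suc d) ≤ ∣ Z ─ Z′ ∣) →
               ¬ ¬ LineConfig Z (3 + m)
      extend r rankZ (d , r≡ , room) with ∃⊂-of-size (Z ─ Z′) room
      ... | T , T⊆S , ∣T∣≡1+d , e , e∈S , e∉T = do
        pairs ← ¬¬-∀-Fin λ i → ¬¬-∀-Fin λ j → ¬¬-→ (pair i j)
        pure record
          { rank = r ; rank-Z = rankZ ; C = C ∪ T ; point = e ∷ᵛ point
          ; C⊆Z = ∪-new-⊆ C⊆Z′ T⊆S
          ; point∈Z = ∀-cons (p─q⊆p Z Z′ e∈S) (Z′⊆Z ∘ point∈Z′)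
          ; point∉C = ∀-cons (∉∪ (new∉Z′ e∈S ∘ C⊆Z′) e∉T) λ i → ∉∪ (point∉C i) λ x∈T → new∉Z′ (T⊆S x∈T) (point∈Z′ i)
          ; point-injective = ∷ᵛ-injective {P = _∈ Z′} (new∉Z′ e∈S) point∈Z′ point-injective
          ; rank≡2+∣C∣ = r≡2+∣C∪T∣ ; pair-indep = λ {i} {j} → pairs i j }
        where
        r≡2+∣C∪T∣ : r ≡ 2 + ∣ C ∪ T ∣
        r≡2+∣C∪T∣ = begin
          r                        ≡⟨ r≡ ⟩
          suc rank + d             ≡⟨ cong (λ x → suc x + d) rank≡2+∣C∣ ⟩
          2 + suc (∣ C ∣ + d)      ≡˘⟨ cong (2 +_) (+-suc ∣ C ∣ d) ⟩
          2 + (∣ C ∣ + suc d)      ≡˘⟨ cong (λ x → 2 + (∣ C ∣ + x)) ∣T∣≡1+d ⟩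
          2 + (∣ C ∣ + ∣ T ∣)      ≡˘⟨ cong (2 +_) (∣∪-new∣ C⊆Z′ T⊆S) ⟩
          2 + ∣ C ∪ T ∣            ∎
          where open ≡-Reasoning
        lift : ∀ {a b I} → a ∈ Z → b ∈ Z → Indep I → C ⊆ I → (a ∈ Z′ → a ∈ I) → (b ∈ Z′ → b ∈ I) →
               ¬ ¬ Indep (C ∪ T +ₛ a +ₛ b)
        lift = ⋖-lift-pair rankZ C⊆Z′ T⊆S r≡2+∣C∪T∣
        e∈Z = p─q⊆p Z Z′ e∈S
        pair : ∀ i j → i ≢ j → ¬ ¬ Indep (C ∪ T +ₛ (e ∷ᵛ point) i +ₛ (e ∷ᵛ point) j)
        pair zero    zero    0≢0 = ⊥-elim (0≢0 refl)
        pair zero    (suc j) _   = lift e∈Z (Z′⊆Z (point∈Z′ j)) (point-indep L j) X⊆X+ₛe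
                                        (⊥-elim ∘ new∉Z′ e∈S) (λ _ → e∈X+ₛe _)
        pair (suc i) zero    _   = lift (Z′⊆Z (point∈Z′ i)) e∈Z (point-indep L i) X⊆X+ₛe
                                        (λ _ → e∈X+ₛe _) (⊥-elim ∘ new∉Z′ e∈S)
        pair (suc i) (suc j) i≢j = lift (Z′⊆Z (point∈Z′ i)) (Z′⊆Z (point∈Z′ j)) (pair-indep (i≢j ∘ cong suc))
                                        (⊆-trans X⊆X+ₛe X⊆X+ₛe) (λ _ → X⊆X+ₛe (e∈X+ₛe _)) (λ _ → e∈X+ₛe _)

  CyclicFlatsBelow : Subset n → ℕ → Set
  CyclicFlatsBelow Z m = Σ (Fin m → Subset n) λ g →
    Injective _≡_ _≡_ g × (∀ i → IsCyclicFlat M (g i)) × (∀ i → g i ⊂ Z)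

  ⊆⇒CyclicFlatsBelow : (g : Fin (suc m) → Subset n) → Injective _≡_ _≡_ g → (∀ i → IsCyclicFlat M (g i)) →
                     (∀ i → g i ⊆ W) → CyclicFlatsBelow W m
  ⊆⇒CyclicFlatsBelow {W = Z} g g-injective cyclic g⊆Z with any? (λ j → g j ≟ₛ Z)
  ... | yes (j , gj≡Z) = g ∘ punchIn j , punchIn-injective j _ _ ∘ g-injective , cyclic ∘ punchIn j ,
                         λ i → ⊆∧≢⇒⊂ (g⊆Z _) λ g[i′]≡Z → punchInᵢ≢i j i (g-injective (trans g[i′]≡Z (sym gj≡Z)))
  ... | no none        = g ∘ suc , suc-injective ∘ g-injective , cyclic ∘ suc ,
                         λ i → ⊆∧≢⇒⊂ (g⊆Z _) λ g[1+i]≡Z → none (suc i , g[1+i]≡Z)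

  ¬¬-predecessor-below : CyclicFlatsChain M → IsCyclicFlat M W → CyclicFlatsBelow W (suc m) →
                         ¬ ¬ (∃ λ Z′ → Z′ ⋖ W × CyclicFlatsBelow Z′ m)
  ¬¬-predecessor-below chain cyclicZ (g , g-injective , cyclic , g⊂Z) = do
    (Z′ , _ , cover) ← ¬¬-predecessor chain (cyclic zero) cyclicZ (g⊂Z zero)
    pure (Z′ , cover , ⊆⇒CyclicFlatsBelow g g-injective cyclic λ i → ⋖-below cover (cyclic i) (g⊂Z i))

  ¬¬-LineConfig-above : CyclicFlatsChain M → IsCyclicFlat M W → CyclicFlatsBelow W (2 + m) → ¬ ¬ LineConfig W (3 + m)
  ¬¬-LineConfig-above {m = zero} chain cyclicZ below = do
    (Z′ , cover , Y , _ , cyclicY , Y⊂Z′) ← ¬¬-predecessor-below chain cyclicZ below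
    (_ , rankY) ← ¬¬-rank (Y zero)
    (suc _ , rankZ′) ← ¬¬-rank Z′
      where (zero , rankZ′) → λ _ → n≮0 (flat-rank-< (proj₁ (cyclicY zero)) (Y⊂Z′ zero) rankY rankZ′)
    ¬¬-LineConfig₃ cover rankZ′
  ¬¬-LineConfig-above {m = suc m} chain cyclicZ below = do
    (Z′ , cover , below′) ← ¬¬-predecessor-below chain cyclicZ below
    L ← ¬¬-LineConfig-above chain (_⋖_.cyclic-lower cover) below′
    ¬¬-LineConfig-suc cover L

  ¬¬-LineConfig : CyclicFlatsChain M → AtLeastCyclicFlats M (3 + m) → ¬ ¬ (∃ λ Z → LineConfig Z (3 + m))
  ¬¬-LineConfig chain (f , f-injective , cyclic)
    with chain-maximum f (λ i j → chain (f i) (f j) (cyclic i) (cyclic j))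
  ... | top , f⊆top =
    ¬¬-map (f top ,_) (¬¬-LineConfig-above chain (cyclic top) (⊆⇒CyclicFlatsBelow f f-injective cyclic f⊆top))

-- Points on a line over a finite field

module _ {q : ℕ} (𝔽 : IsFieldOn (Fin q)) where
  open IsFieldOn 𝔽

  private
    ring : CommutativeRing 0ℓ 0ℓ
    ring = record
      { Carrier = Fin q ; _≈_ = _≡_ ; _+_ = _+ᴷ_ ; _*_ = _*ᴷ_ ; -_ = -ᴷ_ ; 0# = 0ᴷ ; 1# = 1ᴷ
      ; isCommutativeRing = isCommutativeRing }
    open CommutativeRing ring using (*-comm; *-assoc; zeroʳ; -‿inverseʳ)
    open import Algebra.Properties.Ring (CommutativeRing.ring ring) using (-1*x≈-x; [y-z]x≈yx-zx; x∙y⁻¹≈ε⇒x≈y)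
    open import Algebra.Properties.Semiring.Sum (CommutativeRing.semiring ring)
      using (sum; ∑-distrib-+; *-distribˡ-sum; sum-cong-≗)

  Σᴷ≡sum : (f : Fin m → Fin q) → Σᴷ f ≡ sum f
  Σᴷ≡sum {zero}  f = refl
  Σᴷ≡sum {suc m} f = cong (f zero +ᴷ_) (Σᴷ≡sum (f ∘ suc))

  Σᴷ-cong : {f g : Fin m → Fin q} → (∀ i → f i ≡ g i) → Σᴷ f ≡ Σᴷ g
  Σᴷ-cong {f = f} {g} f≗g = trans (Σᴷ≡sum f) (trans (sum-cong-≗ f≗g) (sym (Σᴷ≡sum g)))

  Σᴷ-+ : (f g : Fin m → Fin q) → Σᴷ (λ i → f i +ᴷ g i) ≡ Σᴷ f +ᴷ Σᴷ g
  Σᴷ-+ f g = trans (Σᴷ≡sum (λ i → f i +ᴷ g i)) (trans (∑-distrib-+ f g) (sym (cong₂ _+ᴷ_ (Σᴷ≡sum f) (Σᴷ≡sum g))))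

  Σᴷ-*ˡ : (a : Fin q) (f : Fin m → Fin q) → Σᴷ (λ i → a *ᴷ f i) ≡ a *ᴷ Σᴷ f
  Σᴷ-*ˡ a f = trans (Σᴷ≡sum (λ i → a *ᴷ f i)) (trans (sym (*-distribˡ-sum a f)) (cong (a *ᴷ_) (sym (Σᴷ≡sum f))))

  Σᴷ-neg : (f : Fin m → Fin q) → Σᴷ (λ i → -ᴷ f i) ≡ -ᴷ Σᴷ f
  Σᴷ-neg f = trans (Σᴷ-cong λ i → sym (-1*x≈-x (f i))) (trans (Σᴷ-*ˡ (-ᴷ 1ᴷ) f) (-1*x≈-x (Σᴷ f)))

  module _ {n r : ℕ} (v : Fin n → Fin r → Fin q) where

    record IsRelationOn (X : Subset n) (c : Fin n → Fin q) : Set where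
      field
        supported : ∀ e → e ∉ X → c e ≡ 0ᴷ
        vanishes  : ∀ j → Σᴷ (λ e → c e *ᴷ v e j) ≡ 0ᴷ
    open IsRelationOn

    private
      variable
        X Y : Subset n
        a : Fin n
        c c′ : Fin n → Fin q

    ¬indep⇒relation : ¬ LinIndepOn v X → ¬ ¬ (∃ λ c → IsRelationOn X c × ∃ λ e → c e ≢ 0ᴷ)
    ¬indep⇒relation ¬indep no-relation = ¬indep λ c supp vanish e →
      decidable-stable (c e ≟ᶠ 0ᴷ) λ ce≢0 → no-relation (c , record { supported = supp ; vanishes = vanish } , e , ce≢0)

    relation-⊆ : X ⊆ Y → IsRelationOn X c → IsRelationOn Y c
    relation-⊆ X⊆Y rel = record { supported = λ e e∉Y → supported rel e (e∉Y ∘ X⊆Y) ; vanishes = vanishes rel }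

    relation-drop : IsRelationOn (X +ₛ a) c → c a ≡ 0ᴷ → IsRelationOn X c
    relation-drop {a = a} {c} rel ca≡0 = record { supported = supp ; vanishes = vanishes rel }
      where
      supp : ∀ e → e ∉ _ → c e ≡ 0ᴷ
      supp e e∉X with e ≟ᶠ a
      ... | yes refl = ca≡0
      ... | no e≢a = supported rel e (∉+ₛ e∉X e≢a)

    relation-vanishes : LinIndepOn v X → IsRelationOn (X +ₛ a) c → c a ≡ 0ᴷ → ∀ e → c e ≡ 0ᴷ
    relation-vanishes {c = c} indep rel ca≡0 = indep c (supported rel′) (vanishes rel′)
      where rel′ = relation-drop rel ca≡0

    relation-scale : (w : Fin q) → IsRelationOn X c → IsRelationOn X (λ e → w *ᴷ c e)
    relation-scale {c = c} w rel = record
      { supported = λ e e∉X → trans (cong (w *ᴷ_) (supported rel e e∉X)) (zeroʳ w)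
      ; vanishes  = λ j → begin
          Σᴷ (λ e → (w *ᴷ c e) *ᴷ v e j)  ≡⟨ Σᴷ-cong (λ e → *-assoc w (c e) (v e j)) ⟩
          Σᴷ (λ e → w *ᴷ (c e *ᴷ v e j))  ≡⟨ Σᴷ-*ˡ w (λ e → c e *ᴷ v e j) ⟩
          w *ᴷ Σᴷ (λ e → c e *ᴷ v e j)    ≡⟨ cong (w *ᴷ_) (vanishes rel j) ⟩
          w *ᴷ 0ᴷ                         ≡⟨ zeroʳ w ⟩
          0ᴷ                              ∎ }
      where open ≡-Reasoning

    relation-sub : IsRelationOn X c → IsRelationOn X c′ → IsRelationOn X (λ e → c e +ᴷ (-ᴷ c′ e))
    relation-sub {X} {c} {c′} rel rel′ = record { supported = supp ; vanishes = vanish }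
      where
      supp : ∀ e → e ∉ X → c e +ᴷ (-ᴷ c′ e) ≡ 0ᴷ
      supp e e∉X = trans (cong₂ (λ x y → x +ᴷ (-ᴷ y)) (supported rel e e∉X) (supported rel′ e e∉X)) (-‿inverseʳ 0ᴷ)
      vanish : ∀ j → Σᴷ (λ e → (c e +ᴷ (-ᴷ c′ e)) *ᴷ v e j) ≡ 0ᴷ
      vanish j = begin
        Σᴷ (λ e → (c e +ᴷ (-ᴷ c′ e)) *ᴷ v e j)  ≡⟨ Σᴷ-cong (λ e → [y-z]x≈yx-zx (v e j) (c e) (c′ e)) ⟩
        Σᴷ (λ e → f e +ᴷ (-ᴷ g e))             ≡⟨ Σᴷ-+ f (λ e → -ᴷ g e) ⟩
        Σᴷ f +ᴷ Σᴷ (λ e → -ᴷ g e)              ≡⟨ cong (Σᴷ f +ᴷ_) (Σᴷ-neg g) ⟩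
        Σᴷ f +ᴷ (-ᴷ Σᴷ g)                      ≡⟨ cong₂ (λ x y → x +ᴷ (-ᴷ y)) (vanishes rel j) (vanishes rel′ j) ⟩
        0ᴷ +ᴷ (-ᴷ 0ᴷ)                          ≡⟨ -‿inverseʳ 0ᴷ ⟩
        0ᴷ                                     ∎
        where
        open ≡-Reasoning
        f g : Fin n → Fin q
        f e = c e *ᴷ v e j
        g e = c′ e *ᴷ v e j

    nonzero-at : LinIndepOn v X → IsRelationOn (X +ₛ a) c → ∀ {b} → c b ≢ 0ᴷ → c a ≢ 0ᴷ
    nonzero-at indep rel cb≢0 ca≡0 = cb≢0 (relation-vanishes indep rel ca≡0 _)

    module _ (C : Subset n) (p : Fin (2 + q) → Fin n) (p-injective : Injective _≡_ _≡_ p) (p∉C : ∀ i → p i ∉ C)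
             (independent : ∀ {i j} → i ≢ j → LinIndepOn v (C +ₛ p i +ₛ p j)) where

      private
        x₀ x₁ : Fin n
        x₀ = p zero
        x₁ = p (suc zero)
        y : Fin q → Fin n
        y k = p (suc (suc k))
        T : Fin q → Subset n
        T k = C +ₛ x₀ +ₛ x₁ +ₛ y k

      record NormalisedRelation (k : Fin q) : Set where
        constructor normalisedRelation
        field
          coeff    : Fin n → Fin q
          relation : IsRelationOn (T k) coeff
          coeff-x₀ : coeff x₀ ≡ 1ᴷ

        coeff-x₀≢0 : coeff x₀ ≢ 0ᴷ
        coeff-x₀≢0 c₀≡0 = 0≢1 (trans (sym c₀≡0) coeff-x₀)

        coeff-x₁≢0 : coeff x₁ ≢ 0ᴷ
        coeff-x₁≢0 = nonzero-at (independent {zero} {suc (suc k)} λ ()) (relation-⊆ +ₛ-swap relation) coeff-x₀≢0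

        coeff-y≢0 : coeff (y k) ≢ 0ᴷ
        coeff-y≢0 = nonzero-at (independent {zero} {suc zero} λ ()) relation coeff-x₀≢0

      ¬¬-normalisedRelation : ∀ k → ¬ LinIndepOn v (T k) → ¬ ¬ NormalisedRelation k
      ¬¬-normalisedRelation k dependent = do
        (c , rel , e , ce≢0) ← ¬indep⇒relation dependent
        let T⊆T′ = ⊆-trans (+ₛ-mono +ₛ-swap) +ₛ-swap
            (w , c₀w≡1) = inverse (c x₀)
                            (nonzero-at (independent {suc zero} {suc (suc k)} λ ()) (relation-⊆ T⊆T′ rel) ce≢0)
        pure (normalisedRelation (λ e → w *ᴷ c e) (relation-scale w rel) (trans (*-comm w (c x₀)) c₀w≡1))

      -- For k ≢ l, equal slopes make cₖ − cₗ a relation on C ∪ {y k, y l}, so it vanishes;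
      -- but its coefficient at y l is − cₗ (y l) ≢ 0.
      slope-injective : (N : ∀ k → NormalisedRelation k) → Injective _≡_ _≡_ (λ k → NormalisedRelation.coeff (N k) x₁)
      slope-injective N {k} {l} slope≡ with k ≟ᶠ l
      ... | yes k≡l = k≡l
      ... | no k≢l = ⊥-elim (NormalisedRelation.coeff-y≢0 (N l) (sym (x∙y⁻¹≈ε⇒x≈y 0ᴷ _ (begin
        0ᴷ +ᴷ (-ᴷ cₗ (y l))       ≡˘⟨ cong (λ x → x +ᴷ (-ᴷ cₗ (y l))) (supported relₖ (y l) yₗ∉Tₖ) ⟩
        d (y l)                   ≡⟨ independent 2+k≢2+l d (supported rel-d) (vanishes rel-d) (y l) ⟩
        0ᴷ                        ∎))))
        where
        open ≡-Reasoning
        open NormalisedRelation (N k) renaming (coeff to cₖ; relation to relₖ; coeff-x₀ to cₖx₀≡1)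
        open NormalisedRelation (N l) renaming (coeff to cₗ; relation to relₗ; coeff-x₀ to cₗx₀≡1)
        d : Fin n → Fin q
        d e = cₖ e +ᴷ (-ᴷ cₗ e)
        distinct : ∀ {i j} → i ≢ j → p i ≢ p j
        distinct i≢j = i≢j ∘ p-injective
        2+k≢2+l : _≢_ {A = Fin (2 + q)} (suc (suc k)) (suc (suc l))
        2+k≢2+l = k≢l ∘ suc-injective ∘ suc-injective
        yₗ∉Tₖ : y l ∉ T k
        yₗ∉Tₖ = ∉+ₛ (∉+ₛ (∉+ₛ (p∉C _) (distinct λ ())) (distinct λ ())) (distinct (2+k≢2+l ∘ sym))
        U = C +ₛ y k +ₛ y l +ₛ x₀ +ₛ x₁
        C⊆U : C ⊆ U
        C⊆U = ⊆-trans X⊆X+ₛe (⊆-trans X⊆X+ₛe (⊆-trans X⊆X+ₛe X⊆X+ₛe))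
        x₀x₁⊆U : C +ₛ x₀ +ₛ x₁ ⊆ U
        x₀x₁⊆U = +ₛ-⊆ (+ₛ-⊆ C⊆U (X⊆X+ₛe (e∈X+ₛe x₀))) (e∈X+ₛe x₁)
        rel-d-U : IsRelationOn U d
        rel-d-U = relation-sub (relation-⊆ (+ₛ-⊆ x₀x₁⊆U (X⊆X+ₛe (X⊆X+ₛe (X⊆X+ₛe (e∈X+ₛe (y k)))))) relₖ)
                               (relation-⊆ (+ₛ-⊆ x₀x₁⊆U (X⊆X+ₛe (X⊆X+ₛe (e∈X+ₛe (y l))))) relₗ)
        rel-d : IsRelationOn (C +ₛ y k +ₛ y l) d
        rel-d = relation-drop (relation-drop rel-d-U (trans (cong (λ x → cₖ x₁ +ᴷ (-ᴷ x)) (sym slope≡)) (-‿inverseʳ _)))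
                              (trans (cong₂ (λ x y → x +ᴷ (-ᴷ y)) cₖx₀≡1 cₗx₀≡1) (-‿inverseʳ 1ᴷ))

      line-has-at-most-q+1-points : (∀ k → ¬ LinIndepOn v (T k)) → Empty
      line-has-at-most-q+1-points dependent = ¬¬-∀-Fin (λ k → ¬¬-normalisedRelation k (dependent k)) λ N →
        avoiding⇒¬injective 0ᴷ (λ k → NormalisedRelation.coeff (N k) x₁)
                               (λ k → NormalisedRelation.coeff-x₁≢0 (N k)) (slope-injective N)

LineConfig⇒¬representable : ∀ {n q} {Z : Subset n} (M : Matroid n) (𝔽 : IsFieldOn (Fin q)) →
                            LineConfig M Z (2 + q) → ¬ RepresentableOver 𝔽 M
LineConfig⇒¬representable M 𝔽 L (_ , v , represents) =
  line-has-at-most-q+1-points 𝔽 v C point point-injective point∉C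
    (λ i≢j → proj₁ (represents _) (pair-indep i≢j))
    (λ k → triple-dependent (λ ()) (λ ()) (λ ()) ∘ proj₂ (represents _))
  where open LineConfig L

theorem2p3 : (q : ℕ) → IsPrimePower q → (n : ℕ) → (M : Matroid n) →
    CyclicFlatsChain M → AtLeastCyclicFlats M (q + 2) →
    (𝔽 : IsFieldOn (Fin q)) → ¬ RepresentableOver 𝔽 M
theorem2p3 zero    _ _ _ _     _     𝔽 _ with IsFieldOn.0ᴷ 𝔽
... | ()
theorem2p3 (suc k) _ _ M chain flats 𝔽 representation =
  ¬¬-LineConfig M chain (subst (AtLeastCyclicFlats M) (+-comm (suc k) 2) flats) λ (_ , L) →
    LineConfig⇒¬representable M 𝔽 L representation
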